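{- Let $n\geq 1$. On the set of circular permutations of $S_n$ (that is, $n$-cycles), let $\to$ be the relation defined by $(w)\to(w')$ whenever the word $w$ has a circular factor $sr$ with $s>r+1$ and $w'$ is obtained from $w$ by replacing this factor by $rs$. Then the reflexive and transitive closure of $\to$ is a partial order on the set of circular permutations of $S_n$. The resulting poset is graded by the function $N$, its smallest element is $(1\,2\cdots n)$ and its largest element is $(n\cdots 2\,1)$.
   Context: Permutations $w\in S_n$ are viewed as words $w_1\cdots w_n$ on the alphabet $\{1,\ldots,n\}$. A conjugate of a word $w$ is a word $yx$ where $w=xy$. A circular factor of $w$ is a factor (contiguous subword) of some conjugate of $w$. For a word $w$ which is a permutation of $\{1,\dots,n\}$, $(w)$ denotes the $n$-cycle $w_1\mapsto w_2\mapsto\cdots\mapsto w_n\mapsto w_1$; the $n$-cycles are called circular permutations, and $(w)=(w')$ iff $w,w'$ are conjugate words, so the relation $\to$ does not depend on the chosen representative words. For $1\le i<j\le n$, $\gamma_{ij}(w)=1$ if $j$ appears before $i$ in the word $w$ and $\gamma_{ij}(w)=0$ otherwise. Define $N(w)=\sum_{k=1}^{n-1}k(n-k)\gamma_{k,k+1}(w)-\sum_{1\le i<j\le n}\gamma_{ij}(w)$. $N(w)$ depends only on the circular permutation $(w)$, so $N$ is a function on circular permutations; "graded by $N$" means $N$ is a rank function of the poset (minimal element has rank $0$ and each cover relation increases $N$ by $1$). -}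

module Defs where

open import Data.Nat using (ℕ; zero; suc; _∸_; _<_; _*_; _≡ᵇ_)
open import Data.Integer using (ℤ; +_; _-_)
open import Data.List using (List; []; _∷_; _++_; map; upTo; reverse)
open import Data.Nat.ListAction using (sum)
open import Data.List.Relation.Binary.Permutation.Propositional using (_↭_)
open import Data.Bool using (Bool; true; false; if_then_else_)
open import Data.Product using (Σ; ∃; ∃-syntax; _×_; proj₁)
open import Data.Sum using (_⊎_)
open import Relation.Binary.PropositionalEquality using (_≡_)
open import Relation.Binary.Construct.Closure.ReflexiveTransitive using (Star)
open import Relation.Nullary using (¬_)

one-to : ℕ → List ℕ
one-to n = map suc (upTo n)

to-one : ℕ → List ℕ
to-one n = reverse (one-to n)

IsPermWord : ℕ → List ℕ → Set
IsPermWord n w = w ↭ one-to n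

-- Circular permutations of S_n, represented by (any) word representing them;
-- two words represent the same circular permutation iff they are conjugate.
CircPerm : ℕ → Set
CircPerm n = Σ (List ℕ) (IsPermWord n)

Conj : List ℕ → List ℕ → Set
Conj w v = ∃[ x ] ∃[ y ] (w ≡ x ++ y × v ≡ y ++ x)

Step : List ℕ → List ℕ → Set
Step w w' = ∃[ u ] ∃[ x ] ∃[ y ] ∃[ s ] ∃[ r ]
  (Conj w u × u ≡ x ++ (s ∷ r ∷ y) × suc r < s × Conj (x ++ (r ∷ s ∷ y)) w')

-- Reflexive-transitive closure of → on circular permutations, lifted to words
-- (equality of circular permutations = conjugacy of words).
Leq : List ℕ → List ℕ → Set
Leq = Star (λ a b → Conj a b ⊎ Step a b)

_≈ᶜ_ : ∀ {n} → CircPerm n → CircPerm n → Set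
a ≈ᶜ b = Conj (proj₁ a) (proj₁ b)

_≤ᶜ_ : ∀ {n} → CircPerm n → CircPerm n → Set
a ≤ᶜ b = Leq (proj₁ a) (proj₁ b)

_⋖ᶜ_ : ∀ {n} → CircPerm n → CircPerm n → Set
_⋖ᶜ_ {n} a b = (a ≤ᶜ b) × ¬ (a ≈ᶜ b)
  × ((c : CircPerm n) → a ≤ᶜ c → c ≤ᶜ b → (c ≈ᶜ a) ⊎ (c ≈ᶜ b))

before : List ℕ → ℕ → ℕ → Bool
before [] j i = false
before (x ∷ w) j i = if x ≡ᵇ j then true else (if x ≡ᵇ i then false else before w j i)

γ : ℕ → ℕ → List ℕ → ℕ
γ i j w = if before w j i then 1 else 0

N : ℕ → List ℕ → ℤ
N n w = (+ sum (map (λ k → k * (n ∸ k) * γ k (suc k) w) (one-to (n ∸ 1))))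
      - (+ sum (map (λ j → sum (map (λ i → γ i j w) (one-to (j ∸ 1)))) (one-to n)))

module Submission where

-- N w is the weighted count Σ k(n−k)γ_{k,k+1}(w) minus the number of inversions of w. Rotating a
-- word a·v into v·a reverses the order of a and every other letter: the inversion count changes
-- by (n−a) − (a−1), the weighted count by a(n−a) − (a−1)(n−a+1), and these agree, so N is a
-- function of the circular permutation. A move sr ↦ rs with s > r+1 touches no pair (k, k+1) and
-- removes exactly one inversion, so N rises by exactly one along every move; this gives
-- antisymmetry and the grading.
-- Every word reaches (n ⋯ 1): delete n, reach (n−1 ⋯ 1) by induction and carry n along that path
-- (if n splits a factor s r, it first moves past r, as r+1 < s < n); then n moves right past the
-- letters below n−1 until it stands in front of n−1. Reversing words reverses moves, which turns
-- this into (1 ⋯ n) ≤ (w).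

-- ℕ's _+_ is opened only inside this module, so that the statement at the end can use ℤ's _+_.
module _ where

  open import Defs
  open import Data.Bool using (Bool; true; false; if_then_else_; T)
  open import Data.Empty using (⊥; ⊥-elim)
  open import Data.Integer as ℤ using (+_; _⊖_)
  import Data.Integer.Properties as ℤₚ
  open import Data.List using (List; []; _∷_; _++_; map; upTo; reverse; [_])
  import Data.List.Properties as List
  open import Data.List.Membership.Propositional using (_∈_; _∉_)
  open import Data.List.Membership.Propositional.Properties using (∈-map⁺; ∈-++⁺ʳ; ∈-∃++)
  open import Data.List.Relation.Unary.Any using (here; there)
  open import Data.List.Relation.Unary.All as All using (All; []; _∷_)
  import Data.List.Relation.Unary.All.Properties as All
  open import Data.List.Relation.Unary.AllPairs using (_∷_)
  open import Data.List.Relation.Unary.Unique.Propositional using (Unique)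
  import Data.List.Relation.Unary.Unique.Propositional.Properties as Unique
  open import Data.List.Relation.Binary.Permutation.Propositional
    using (_↭_; ↭-refl; ↭-sym; ↭-trans; ↭-swap; ↭⇒↭ₛ)
  import Data.List.Relation.Binary.Permutation.Propositional.Properties as ↭
  import Data.List.Relation.Binary.Permutation.Setoid.Properties as ↭ₛ
  open import Data.Nat using (ℕ; zero; suc; _+_; _*_; _∸_; _≤_; _<_; z≤n; s≤s; _≡ᵇ_; _≟_)
  import Data.Nat.Properties as ℕ
  open import Data.Nat.ListAction using (sum)
  open import Data.Nat.ListAction.Properties using (sum-++)
  open import Data.Nat.Tactic.RingSolver using (solve-∀)
  open import Data.Product using (∃-syntax; _×_; _,_; proj₁; proj₂; uncurry)
  open import Data.Sum using (_⊎_; inj₁; inj₂)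
  open import Data.Unit using (tt)
  open import Function using (id; _∘_)
  open import Relation.Nullary using (¬_; yes; no)
  open import Relation.Binary.PropositionalEquality hiding ([_])
  open import Relation.Binary.Structures using (IsPartialOrder)
  import Relation.Binary.Construct.Closure.ReflexiveTransitive as Star
  open Star using (ε; _◅_; _◅◅_)

  -- Conjugacy, moves and reversal

  ++-≡-++-split : ∀ {A : Set} (y x p q : List A) → y ++ x ≡ p ++ q →
    (∃[ m ] (p ≡ y ++ m × x ≡ m ++ q)) ⊎ (∃[ m ] (y ≡ p ++ m × q ≡ m ++ x))
  ++-≡-++-split [] x p q e = inj₁ (p , refl , e)
  ++-≡-++-split (c ∷ y) x [] q e = inj₂ (c ∷ y , refl , sym e)
  ++-≡-++-split (c ∷ y) x (d ∷ p) q e with List.∷-injective e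
  ... | refl , e′ with ++-≡-++-split y x p q e′
  ... | inj₁ (m , e₁ , e₂) = inj₁ (m , cong (c ∷_) e₁ , e₂)
  ... | inj₂ (m , e₁ , e₂) = inj₂ (m , cong (c ∷_) e₁ , e₂)

  Conj-refl : ∀ w → Conj w w
  Conj-refl w = [] , w , refl , sym (List.++-identityʳ w)

  Conj-reflexive : ∀ {w v} → w ≡ v → Conj w v
  Conj-reflexive {w} refl = Conj-refl w

  Conj-sym : ∀ {w v} → Conj w v → Conj v w
  Conj-sym (x , y , e₁ , e₂) = y , x , e₂ , e₁

  Conj-trans : ∀ {w u v} → Conj w u → Conj u v → Conj w v
  Conj-trans (x , y , refl , refl) (p , q , e , refl) with ++-≡-++-split y x p q e
  ... | inj₁ (m , refl , refl) = m , q ++ y , List.++-assoc m q y , sym (List.++-assoc q y m)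
  ... | inj₂ (m , refl , refl) = x ++ p , m , sym (List.++-assoc x p m) , List.++-assoc m x p

  reverse-Conj : ∀ {w v} → Conj w v → Conj (reverse w) (reverse v)
  reverse-Conj (x , y , refl , refl) =
    reverse y , reverse x , List.reverse-++ x y , List.reverse-++ y x

  Move : List ℕ → List ℕ → Set
  Move w v = Conj w v ⊎ Step w v

  swap-Step : ∀ {w w′} x s r y →
    w ≡ x ++ s ∷ r ∷ y → suc r < s → w′ ≡ x ++ r ∷ s ∷ y → Step w w′
  swap-Step x s r y w≡ r+1<s w′≡ =
    x ++ s ∷ r ∷ y , x , y , s , r , Conj-reflexive w≡ , refl , r+1<s , Conj-reflexive (sym w′≡)

  reverse-swap : ∀ x (s r : ℕ) y → reverse (x ++ s ∷ r ∷ y) ≡ reverse y ++ r ∷ s ∷ reverse x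
  reverse-swap x s r y = begin
    reverse (x ++ s ∷ r ∷ y)
      ≡⟨ List.reverse-++ x (s ∷ r ∷ y) ⟩
    reverse (s ∷ r ∷ y) ++ reverse x
      ≡⟨ cong (_++ reverse x) (List.reverse-++ (s ∷ r ∷ []) y) ⟩
    (reverse y ++ r ∷ s ∷ []) ++ reverse x
      ≡⟨ List.++-assoc (reverse y) (r ∷ s ∷ []) (reverse x) ⟩
    reverse y ++ r ∷ s ∷ reverse x ∎
    where open ≡-Reasoning

  reverse-Step : ∀ {w v} → Step w v → Step (reverse v) (reverse w)
  reverse-Step (u , x , y , s , r , w~u , refl , r+1<s , u′~v) =
    reverse (x ++ r ∷ s ∷ y) , reverse y , reverse x , s , r ,
    reverse-Conj (Conj-sym u′~v) , reverse-swap x r s y , r+1<s ,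
    Conj-trans (Conj-reflexive (sym (reverse-swap x s r y))) (reverse-Conj (Conj-sym w~u))

  reverse-Move : ∀ {w v} → Move w v → Move (reverse v) (reverse w)
  reverse-Move (inj₁ w~v) = inj₁ (reverse-Conj (Conj-sym w~v))
  reverse-Move (inj₂ w→v) = inj₂ (reverse-Step w→v)

  reverse-Leq : ∀ {w v} → Leq w v → Leq (reverse v) (reverse w)
  reverse-Leq w≤v = Star.reverse id (Star.gmap reverse reverse-Move w≤v)

  Conj⇒↭ : ∀ {w v} → Conj w v → w ↭ v
  Conj⇒↭ (x , y , refl , refl) = ↭.++-comm x y

  Step⇒↭ : ∀ {w v} → Step w v → w ↭ v
  Step⇒↭ (u , x , y , s , r , w~u , refl , _ , u′~v) =
    ↭-trans (Conj⇒↭ w~u) (↭-trans (↭.++⁺ˡ x (↭-swap s r ↭-refl)) (Conj⇒↭ u′~v))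

  Move⇒↭ : ∀ {w v} → Move w v → w ↭ v
  Move⇒↭ (inj₁ w~v) = Conj⇒↭ w~v
  Move⇒↭ (inj₂ w→v) = Step⇒↭ w→v

  Leq⇒↭ : ∀ {w v} → Leq w v → w ↭ v
  Leq⇒↭ = Star.fold _↭_ (↭-trans ∘ Move⇒↭) ↭-refl

  IsPermWord-resp-Leq : ∀ {n w v} → Leq w v → IsPermWord n w → IsPermWord n v
  IsPermWord-resp-Leq w≤v = ↭-trans (↭-sym (Leq⇒↭ w≤v))

  one-to-snoc : ∀ n → one-to (suc n) ≡ one-to n ++ [ suc n ]
  one-to-snoc n = trans (cong (map suc) (sym (List.upTo-∷ʳ n))) (List.map-++ suc (upTo n) [ n ])

  one-to-cons : ∀ n → one-to (suc n) ≡ 1 ∷ map suc (one-to n)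
  one-to-cons n = cong (λ l → 1 ∷ map suc l) (sym (List.map-upTo suc n))

  to-one-suc : ∀ n → to-one (suc n) ≡ suc n ∷ to-one n
  to-one-suc n = trans (cong reverse (one-to-snoc n)) (List.reverse-++ (one-to n) [ suc n ])

  InRange : ℕ → ℕ → Set
  InRange n i = 1 ≤ i × i ≤ n

  one-to-inRange : ∀ n → All (InRange n) (one-to n)
  one-to-inRange zero = []
  one-to-inRange (suc n) rewrite one-to-cons n =
    (s≤s z≤n , s≤s z≤n) ∷
      All.map⁺ (All.map (λ (_ , i≤n) → s≤s z≤n , s≤s i≤n) (one-to-inRange n))

  ∈-one-to⁺ : ∀ {n i} → InRange n i → i ∈ one-to n
  ∈-one-to⁺ {suc n} {suc zero} _ rewrite one-to-cons n = here refl
  ∈-one-to⁺ {suc n} {suc (suc i)} (_ , s≤s i<n) rewrite one-to-cons n =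
    there (∈-map⁺ suc (∈-one-to⁺ (s≤s z≤n , i<n)))

  ∈-one-to⁻ : ∀ {n i} → i ∈ one-to n → InRange n i
  ∈-one-to⁻ {n} = All.lookup (one-to-inRange n)

  one-to-unique : ∀ n → Unique (one-to n)
  one-to-unique n = Unique.map⁺ ℕ.suc-injective (Unique.upTo⁺ n)

  IsPermWord-∈⁺ : ∀ {n w i} → IsPermWord n w → InRange n i → i ∈ w
  IsPermWord-∈⁺ p i∈ = ↭.∈-resp-↭ (↭-sym p) (∈-one-to⁺ i∈)

  IsPermWord-∈⁻ : ∀ {n w i} → IsPermWord n w → i ∈ w → InRange n i
  IsPermWord-∈⁻ p i∈w = ∈-one-to⁻ (↭.∈-resp-↭ p i∈w)

  IsPermWord-bounded : ∀ {n w} → IsPermWord n w → All (_≤ n) w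
  IsPermWord-bounded {n} p = ↭.All-resp-↭ (↭-sym p) (All.map proj₂ (one-to-inRange n))

  to-one-bounded : ∀ n → All (_≤ n) (to-one n)
  to-one-bounded n = IsPermWord-bounded (↭.↭-reverse (one-to n))

  IsPermWord-unique : ∀ {n w} → IsPermWord n w → Unique w
  IsPermWord-unique {n} p = ↭ₛ.Unique-resp-↭ (setoid ℕ) (↭⇒↭ₛ (↭-sym p)) (one-to-unique n)

  Unique-++-∉ : ∀ (x : List ℕ) {z c} → Unique (x ++ z) → c ∈ z → c ∉ x
  Unique-++-∉ (d ∷ x) (d∉ ∷ _) c∈z (here refl) = All.lookup d∉ (∈-++⁺ʳ x c∈z) refl
  Unique-++-∉ (d ∷ x) (_ ∷ u) c∈z (there c∈x) = Unique-++-∉ x u c∈z c∈x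

  -- Relative order of two letters

  ≡ᵇ-refl : ∀ n → (n ≡ᵇ n) ≡ true
  ≡ᵇ-refl zero = refl
  ≡ᵇ-refl (suc n) = ≡ᵇ-refl n

  ≡ᵇ≡true⇒≡ : ∀ {m n} → (m ≡ᵇ n) ≡ true → m ≡ n
  ≡ᵇ≡true⇒≡ {m} {n} e = ℕ.≡ᵇ⇒≡ m n (subst T (sym e) tt)

  ≡ᵇ≡false⇒≢ : ∀ {m n} → (m ≡ᵇ n) ≡ false → m ≢ n
  ≡ᵇ≡false⇒≢ {m} e refl with trans (sym (≡ᵇ-refl m)) e
  ... | ()

  ≢⇒≡ᵇ≡false : ∀ {m n} → m ≢ n → (m ≡ᵇ n) ≡ false
  ≢⇒≡ᵇ≡false {m} {n} m≢n with m ≡ᵇ n in e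
  ... | true = ⊥-elim (m≢n (≡ᵇ≡true⇒≡ e))
  ... | false = refl

  nested-if-comm : ∀ (a b c d B : Bool) →
    (a ≡ true → c ≡ true → ⊥) → (b ≡ true → d ≡ true → ⊥) →
    (a ≡ true → d ≡ true → ⊥) → (c ≡ true → b ≡ true → ⊥) →
    (if a then true else (if b then false else (if c then true else (if d then false else B))))
    ≡ (if c then true else (if d then false else (if a then true else (if b then false else B))))
  nested-if-comm true b true d B a∧c _ _ _ = ⊥-elim (a∧c refl refl)
  nested-if-comm true b false true B _ _ a∧d _ = ⊥-elim (a∧d refl refl)
  nested-if-comm true b false false B _ _ _ _ = refl
  nested-if-comm false true true d B _ _ _ c∧b = ⊥-elim (c∧b refl refl)
  nested-if-comm false true false true B _ b∧d _ _ = ⊥-elim (b∧d refl refl)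
  nested-if-comm false true false false B _ _ _ _ = refl
  nested-if-comm false false c d B _ _ _ _ = refl

  before-swap : ∀ x {s r} y {j i} → s ≢ r → ¬ (j ≡ s × i ≡ r) → ¬ (j ≡ r × i ≡ s) →
    before (x ++ s ∷ r ∷ y) j i ≡ before (x ++ r ∷ s ∷ y) j i
  before-swap [] {s} {r} y {j} {i} s≢r ¬sr ¬rs =
    nested-if-comm (s ≡ᵇ j) (s ≡ᵇ i) (r ≡ᵇ j) (r ≡ᵇ i) (before y j i)
      (λ e₁ e₂ → s≢r (trans (≡ᵇ≡true⇒≡ e₁) (sym (≡ᵇ≡true⇒≡ e₂))))
      (λ e₁ e₂ → s≢r (trans (≡ᵇ≡true⇒≡ e₁) (sym (≡ᵇ≡true⇒≡ e₂))))
      (λ e₁ e₂ → ¬sr (sym (≡ᵇ≡true⇒≡ e₁) , sym (≡ᵇ≡true⇒≡ e₂)))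
      (λ e₁ e₂ → ¬rs (sym (≡ᵇ≡true⇒≡ e₁) , sym (≡ᵇ≡true⇒≡ e₂)))
  before-swap (c ∷ x) y {j} {i} s≢r ¬sr ¬rs =
    cong (λ b → if c ≡ᵇ j then true else (if c ≡ᵇ i then false else b))
      (before-swap x y s≢r ¬sr ¬rs)

  before-++ʳ : ∀ x z {j i} → j ∉ x → i ∉ x → before (x ++ z) j i ≡ before z j i
  before-++ʳ [] z _ _ = refl
  before-++ʳ (c ∷ x) z {j} {i} j∉ i∉
    rewrite ≢⇒≡ᵇ≡false {c} {j} (λ e → j∉ (here (sym e)))
          | ≢⇒≡ᵇ≡false {c} {i} (λ e → i∉ (here (sym e)))
    = before-++ʳ x z (j∉ ∘ there) (i∉ ∘ there)

  before-++ˡ : ∀ v z {j i} → j ∈ v ⊎ i ∈ v → before (v ++ z) j i ≡ before v j i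
  before-++ˡ [] z (inj₁ ())
  before-++ˡ [] z (inj₂ ())
  before-++ˡ (c ∷ v) z {j} {i} j∨i∈ with c ≡ᵇ j in c≡ᵇj
  ... | true = refl
  ... | false with c ≡ᵇ i in c≡ᵇi
  ...   | true = refl
  ...   | false = before-++ˡ v z (narrow j∨i∈)
    where
    narrow : j ∈ c ∷ v ⊎ i ∈ c ∷ v → j ∈ v ⊎ i ∈ v
    narrow (inj₁ (here j≡c)) = ⊥-elim (≡ᵇ≡false⇒≢ c≡ᵇj (sym j≡c))
    narrow (inj₁ (there j∈v)) = inj₁ j∈v
    narrow (inj₂ (here i≡c)) = ⊥-elim (≡ᵇ≡false⇒≢ c≡ᵇi (sym i≡c))
    narrow (inj₂ (there i∈v)) = inj₂ i∈v

  before-true : ∀ v z {j i} → j ∈ v → i ∉ v → before (v ++ z) j i ≡ true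
  before-true (c ∷ v) z (here refl) _ rewrite ≡ᵇ-refl c = refl
  before-true (c ∷ v) z {j} {i} (there j∈v) i∉ with c ≡ᵇ j
  ... | true = refl
  ... | false rewrite ≢⇒≡ᵇ≡false {c} {i} (λ e → i∉ (here (sym e))) =
    before-true v z j∈v (i∉ ∘ there)

  before-false : ∀ v z {j i} → i ∈ v → j ∉ v → before (v ++ z) j i ≡ false
  before-false (c ∷ v) z {j} {i} i∈ j∉
    rewrite ≢⇒≡ᵇ≡false {c} {j} (λ e → j∉ (here (sym e))) with i∈
  ... | here refl rewrite ≡ᵇ-refl c = refl
  ... | there i∈v with c ≡ᵇ i
  ...   | true = refl
  ...   | false = before-false v z i∈v (j∉ ∘ there)

  before-map-suc : ∀ l j i → before (map suc l) (suc j) (suc i) ≡ before l j i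
  before-map-suc [] j i = refl
  before-map-suc (c ∷ l) j i =
    cong (λ b → if c ≡ᵇ j then true else (if c ≡ᵇ i then false else b)) (before-map-suc l j i)

  before-one-to : ∀ m {i j} → 1 ≤ i → i < j → before (one-to m) j i ≡ false
  before-one-to zero _ _ = refl
  before-one-to (suc m) {suc zero} {suc zero} _ (s≤s ())
  before-one-to (suc m) {suc zero} {suc (suc j)} _ _ =
    cong (λ l → before l (suc (suc j)) 1) (one-to-cons m)
  before-one-to (suc m) {suc (suc i)} {suc (suc j)} _ (s≤s i<j) = begin
    before (one-to (suc m)) (2 + j) (2 + i)
      ≡⟨ cong (λ l → before l (2 + j) (2 + i)) (one-to-cons m) ⟩
    before (map suc (one-to m)) (2 + j) (2 + i)
      ≡⟨ before-map-suc (one-to m) (suc j) (suc i) ⟩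
    before (one-to m) (suc j) (suc i)
      ≡⟨ before-one-to m (s≤s z≤n) i<j ⟩
    false ∎
    where open ≡-Reasoning

  sum-one-to-suc : ∀ (f : ℕ → ℕ) m →
    sum (map f (one-to (suc m))) ≡ sum (map f (one-to m)) + f (suc m)
  sum-one-to-suc f m = begin
    sum (map f (one-to (suc m)))             ≡⟨ cong (sum ∘ map f) (one-to-snoc m) ⟩
    sum (map f (one-to m ++ [ suc m ]))      ≡⟨ cong sum (List.map-++ f (one-to m) [ suc m ]) ⟩
    sum (map f (one-to m) ++ [ f (suc m) ])  ≡⟨ sum-++ (map f (one-to m)) [ f (suc m) ] ⟩
    sum (map f (one-to m)) + (f (suc m) + 0) ≡⟨ cong (_+_ _) (ℕ.+-identityʳ (f (suc m))) ⟩
    sum (map f (one-to m)) + f (suc m)       ∎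
    where open ≡-Reasoning

  sum-map-+ : ∀ (f g : ℕ → ℕ) l →
    sum (map (λ x → f x + g x) l) ≡ sum (map f l) + sum (map g l)
  sum-map-+ f g [] = refl
  sum-map-+ f g (x ∷ l) rewrite sum-map-+ f g l =
    interchange (f x) (g x) (sum (map f l)) (sum (map g l))
    where
    interchange : ∀ a b c d → a + b + (c + d) ≡ a + c + (b + d)
    interchange = solve-∀

  sum-map-0 : ∀ (l : List ℕ) → sum (map (λ _ → 0) l) ≡ 0
  sum-map-0 [] = refl
  sum-map-0 (x ∷ l) = sum-map-0 l

  sum-one-to-1 : ∀ m → sum (map (λ _ → 1) (one-to m)) ≡ m
  sum-one-to-1 zero = refl
  sum-one-to-1 (suc m) rewrite sum-one-to-suc (λ _ → 1) m | sum-one-to-1 m = ℕ.+-comm m 1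

  sum-map-cong-All : ∀ {P : ℕ → Set} {f g : ℕ → ℕ} {l} →
    All P l → (∀ x → P x → f x ≡ g x) → sum (map f l) ≡ sum (map g l)
  sum-map-cong-All [] _ = refl
  sum-map-cong-All (px ∷ pl) f≡g = cong₂ _+_ (f≡g _ px) (sum-map-cong-All pl f≡g)

  sum-one-to-cong : ∀ {f g : ℕ → ℕ} m → (∀ x → InRange m x → f x ≡ g x) →
    sum (map f (one-to m)) ≡ sum (map g (one-to m))
  sum-one-to-cong m = sum-map-cong-All (one-to-inRange m)

  δ : ℕ → ℕ → ℕ
  δ x b = if x ≡ᵇ b then 1 else 0

  δ-refl : ∀ a → δ a a ≡ 1
  δ-refl a rewrite ≡ᵇ-refl a = refl

  δ-≢ : ∀ {x b} → x ≢ b → δ x b ≡ 0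
  δ-≢ x≢b rewrite ≢⇒≡ᵇ≡false x≢b = refl

  sum-δ-∉ : ∀ (h : ℕ → ℕ) m {b} → ¬ InRange m b →
    sum (map (λ k → h k * δ k b) (one-to m)) ≡ 0
  sum-δ-∉ h m b∉ = trans (sum-one-to-cong m term≡0) (sum-map-0 (one-to m))
    where
    term≡0 : ∀ k → InRange m k → h k * δ k _ ≡ 0
    term≡0 k k∈ = trans (cong (h k *_) (δ-≢ {k} (λ { refl → b∉ k∈ }))) (ℕ.*-zeroʳ (h k))

  sum-δ-∈ : ∀ (h : ℕ → ℕ) m {b} → InRange m b →
    sum (map (λ k → h k * δ k b) (one-to m)) ≡ h b
  sum-δ-∈ h zero (s≤s _ , ())
  sum-δ-∈ h (suc m) {b} (1≤b , b≤1+m) rewrite sum-one-to-suc (λ k → h k * δ k b) m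
    with ℕ.m≤n⇒m<n∨m≡n b≤1+m
  ... | inj₁ b<1+m rewrite sum-δ-∈ h m (1≤b , ℕ.≤-pred b<1+m) | δ-≢ (ℕ.>⇒≢ b<1+m) =
    trans (cong (_+_ (h b)) (ℕ.*-zeroʳ (h (suc m)))) (ℕ.+-identityʳ (h b))
  ... | inj₂ refl rewrite sum-δ-∉ h m (ℕ.1+n≰n ∘ proj₂) | δ-refl (suc m) =
    ℕ.*-identityʳ (h (suc m))

  sum-δ : ∀ (h : ℕ → ℕ) m b → h 0 ≡ 0 → h (suc m) ≡ 0 → b ≤ suc m →
    sum (map (λ k → h k * δ k b) (one-to m)) ≡ h b
  sum-δ h m zero h0≡0 _ _ = trans (sum-δ-∉ h m (λ { (() , _) })) (sym h0≡0)
  sum-δ h m (suc b) _ h[1+m]≡0 b<1+m with ℕ.m≤n⇒m<n∨m≡n b<1+m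
  ... | inj₁ b<m = sum-δ-∈ h m (s≤s z≤n , ℕ.≤-pred b<m)
  ... | inj₂ refl = trans (sum-δ-∉ h m (ℕ.1+n≰n ∘ proj₂)) (sym h[1+m]≡0)

  sum-δ-suc : ∀ (h : ℕ → ℕ) m {b} → h 0 ≡ 0 → h (suc m) ≡ 0 → InRange (suc m) b →
    sum (map (λ k → h k * δ (suc k) b) (one-to m)) ≡ h (b ∸ 1)
  sum-δ-suc h m {suc b} h0≡0 h[1+m]≡0 (_ , b<1+m) = sum-δ h m b h0≡0 h[1+m]≡0 (ℕ.<⇒≤ b<1+m)

  sum-δ-below : ∀ m {a} → 1 ≤ a →
    sum (map (λ j → sum (map (λ i → 1 * δ i a) (one-to (j ∸ 1)))) (one-to m)) ≡ m ∸ a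
  sum-δ-below zero {a} _ = sym (ℕ.0∸n≡0 a)
  sum-δ-below (suc m) {a} 1≤a
    rewrite sum-one-to-suc (λ j → sum (map (λ i → 1 * δ i a) (one-to (j ∸ 1)))) m
          | sum-δ-below m 1≤a
    with ℕ.≤-<-connex a m
  ... | inj₁ a≤m rewrite sum-δ-∈ (λ _ → 1) m (1≤a , a≤m) =
    trans (ℕ.+-comm (m ∸ a) 1) (sym (ℕ.+-∸-assoc 1 a≤m))
  ... | inj₂ m<a
    rewrite sum-δ-∉ (λ _ → 1) m (ℕ.<⇒≱ m<a ∘ proj₂) | ℕ.m≤n⇒m∸n≡0 (ℕ.<⇒≤ m<a) =
    sym (ℕ.m≤n⇒m∸n≡0 m<a)

  -- N as weighted descents minus inversions

  [+m]-[+n]≡[+p]-[+q] : ∀ {m n p q} → m + q ≡ p + n → + m ℤ.- + n ≡ + p ℤ.- + q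
  [+m]-[+n]≡[+p]-[+q] {m} {n} {p} {q} m+q≡p+n = begin
    + m ℤ.- + n        ≡⟨ ℤₚ.[+m]-[+n]≡m⊖n m n ⟩
    m ⊖ n              ≡⟨ sym (ℤₚ.+-cancelˡ-⊖ q m n) ⟩
    (q + m) ⊖ (q + n)  ≡⟨ cong₂ _⊖_ q+m≡n+p (ℕ.+-comm q n) ⟩
    (n + p) ⊖ (n + q)  ≡⟨ ℤₚ.+-cancelˡ-⊖ n p q ⟩
    p ⊖ q              ≡⟨ sym (ℤₚ.[+m]-[+n]≡m⊖n p q) ⟩
    + p ℤ.- + q        ∎
    where
    open ≡-Reasoning
    q+m≡n+p : q + m ≡ n + p
    q+m≡n+p = trans (ℕ.+-comm q m) (trans m+q≡p+n (ℕ.+-comm p n))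

  [+m]-[+n]≡[+m]-[+1+n]+1 : ∀ m n → + m ℤ.- + n ≡ (+ m ℤ.- + suc n) ℤ.+ + 1
  [+m]-[+n]≡[+m]-[+1+n]+1 m n = begin
    + m ℤ.- + n                 ≡⟨ ℤₚ.[+m]-[+n]≡m⊖n m n ⟩
    m ⊖ n                       ≡⟨ sym (ℤₚ.[1+m]⊖[1+n]≡m⊖n m n) ⟩
    suc m ⊖ suc n               ≡⟨ cong (_⊖ suc n) (ℕ.+-comm 1 m) ⟩
    (m + 1) ⊖ suc n             ≡⟨ sym (ℤₚ.distribˡ-⊖-+-pos 1 m (suc n)) ⟩
    (m ⊖ suc n) ℤ.+ + 1         ≡⟨ cong (ℤ._+ + 1) (sym (ℤₚ.[+m]-[+n]≡m⊖n m (suc n))) ⟩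
    (+ m ℤ.- + suc n) ℤ.+ + 1   ∎
    where open ≡-Reasoning

  -- With these, N n w unfolds to + descentWeight n w ℤ.- + inversions n w.
  inversionsAt : ℕ → List ℕ → ℕ
  inversionsAt j w = sum (map (λ i → γ i j w) (one-to (j ∸ 1)))

  inversions : ℕ → List ℕ → ℕ
  inversions n w = sum (map (λ j → inversionsAt j w) (one-to n))

  weight : ℕ → ℕ → ℕ
  weight n k = k * (n ∸ k)

  descentWeight : ℕ → List ℕ → ℕ
  descentWeight n w = sum (map (λ k → weight n k * γ k (suc k) w) (one-to (n ∸ 1)))

  weight-self : ∀ n → weight n n ≡ 0
  weight-self n = trans (cong (n *_) (ℕ.n∸n≡0 n)) (ℕ.*-zeroʳ n)

  m<n⇒n∸m≡1+[n∸1+m] : ∀ {m n} → m < n → n ∸ m ≡ suc (n ∸ suc m)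
  m<n⇒n∸m≡1+[n∸1+m] {zero} {suc n} _ = refl
  m<n⇒n∸m≡1+[n∸1+m] {suc m} {suc n} (s≤s m<n) = m<n⇒n∸m≡1+[n∸1+m] m<n

  weight-pred : ∀ {n a} → 1 ≤ a → a ≤ n →
    weight n (a ∸ 1) + (n ∸ a) ≡ weight n a + (a ∸ 1)
  weight-pred {n} {suc a} _ a<n rewrite m<n⇒n∸m≡1+[n∸1+m] a<n = ring a (n ∸ suc a)
    where
    ring : ∀ a b → a * suc b + b ≡ suc a * b + a
    ring = solve-∀

  InRange-∸1⇒< : ∀ {i j} → 1 ≤ j → InRange (j ∸ 1) i → i < j
  InRange-∸1⇒< {j = suc j} _ (_ , i≤j) = s≤s i≤j

  m<n⇒m≤n∸1 : ∀ {m n} → m < n → m ≤ n ∸ 1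
  m<n⇒m≤n∸1 (s≤s m≤n) = m≤n

  module SwapFactor {n x s r y} (p : IsPermWord n (x ++ s ∷ r ∷ y)) (r+1<s : suc r < s) where

    private
      w w′ : List ℕ
      w = x ++ s ∷ r ∷ y
      w′ = x ++ r ∷ s ∷ y

      r<s : r < s
      r<s = ℕ.<-trans (ℕ.n<1+n r) r+1<s

      s∉x : s ∉ x
      s∉x = Unique-++-∉ x (IsPermWord-unique p) (here refl)

      r∉x : r ∉ x
      r∉x = Unique-++-∉ x (IsPermWord-unique p) (there (here refl))

      s∈ : InRange n s
      s∈ = IsPermWord-∈⁻ p (∈-++⁺ʳ x (here refl))

      r∈ : InRange n r
      r∈ = IsPermWord-∈⁻ p (∈-++⁺ʳ x (there (here refl)))

      γ-unchanged : ∀ i j → ¬ (j ≡ s × i ≡ r) → ¬ (j ≡ r × i ≡ s) →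
        γ i j w′ ≡ γ i j w
      γ-unchanged i j ¬sr ¬rs =
        cong (λ b → if b then 1 else 0) (sym (before-swap x y (ℕ.>⇒≢ r<s) ¬sr ¬rs))

      γ-r-s : γ r s w ≡ 1
      γ-r-s rewrite before-++ʳ x (s ∷ r ∷ y) s∉x r∉x | ≡ᵇ-refl s = refl

      γ-r-s′ : γ r s w′ ≡ 0
      γ-r-s′ rewrite before-++ʳ x (r ∷ s ∷ y) s∉x r∉x | ≢⇒≡ᵇ≡false (ℕ.<⇒≢ r<s) | ≡ᵇ-refl r =
        refl

      γ-i-s : ∀ i → γ i s w ≡ γ i s w′ + 1 * δ i r
      γ-i-s i with i ≟ r
      ... | yes refl rewrite γ-r-s | γ-r-s′ | δ-refl i = refl
      ... | no i≢r rewrite δ-≢ i≢r =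
        trans (sym (γ-unchanged i s (i≢r ∘ proj₂) (ℕ.>⇒≢ r<s ∘ proj₁)))
          (sym (ℕ.+-identityʳ _))

      inversionsAt-s : inversionsAt s w ≡ inversionsAt s w′ + 1
      inversionsAt-s = begin
        inversionsAt s w
          ≡⟨ cong sum (List.map-cong γ-i-s (one-to (s ∸ 1))) ⟩
        sum (map (λ i → γ i s w′ + 1 * δ i r) (one-to (s ∸ 1)))
          ≡⟨ sum-map-+ (λ i → γ i s w′) (λ i → 1 * δ i r) (one-to (s ∸ 1)) ⟩
        inversionsAt s w′ + sum (map (λ i → 1 * δ i r) (one-to (s ∸ 1)))
          ≡⟨ cong (_+_ _) (sum-δ-∈ (λ _ → 1) (s ∸ 1) (proj₁ r∈ , m<n⇒m≤n∸1 r<s)) ⟩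
        inversionsAt s w′ + 1 ∎
        where open ≡-Reasoning

      inversionsAt-≢s : ∀ {j} → j ≢ s → inversionsAt j w ≡ inversionsAt j w′
      inversionsAt-≢s {j} j≢s =
        sum-one-to-cong (j ∸ 1) (λ i i∈ → sym (γ-unchanged i j (j≢s ∘ proj₁) (¬rs i∈)))
        where
        ¬rs : ∀ {i} → InRange (j ∸ 1) i → ¬ (j ≡ r × i ≡ s)
        ¬rs (_ , s≤r∸1) (refl , refl) = ℕ.<⇒≱ r<s (ℕ.≤-trans s≤r∸1 (ℕ.m∸n≤m r 1))

      inversionsAt-j : ∀ j → inversionsAt j w ≡ inversionsAt j w′ + 1 * δ j s
      inversionsAt-j j with j ≟ s
      ... | yes refl rewrite δ-refl j = inversionsAt-s
      ... | no j≢s rewrite δ-≢ j≢s = trans (inversionsAt-≢s j≢s) (sym (ℕ.+-identityʳ _))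

    descentWeight-swap : descentWeight n w′ ≡ descentWeight n w
    descentWeight-swap = cong sum (List.map-cong term-unchanged (one-to (n ∸ 1)))
      where
      term-unchanged : ∀ k → weight n k * γ k (suc k) w′ ≡ weight n k * γ k (suc k) w
      term-unchanged k = cong (weight n k *_) (γ-unchanged k (suc k) ¬sr ¬rs)
        where
        ¬sr : ¬ (suc k ≡ s × k ≡ r)
        ¬sr (1+k≡s , refl) = ℕ.<-irrefl 1+k≡s r+1<s
        ¬rs : ¬ (suc k ≡ r × k ≡ s)
        ¬rs (refl , refl) = ℕ.<-asym (ℕ.n<1+n k) r<s

    inversions-swap : inversions n w ≡ suc (inversions n w′)
    inversions-swap = begin
      inversions n w
        ≡⟨ cong sum (List.map-cong inversionsAt-j (one-to n)) ⟩
      sum (map (λ j → inversionsAt j w′ + 1 * δ j s) (one-to n))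
        ≡⟨ sum-map-+ (λ j → inversionsAt j w′) (λ j → 1 * δ j s) (one-to n) ⟩
      inversions n w′ + sum (map (λ j → 1 * δ j s) (one-to n))
        ≡⟨ cong (_+_ _) (sum-δ-∈ (λ _ → 1) n s∈) ⟩
      inversions n w′ + 1
        ≡⟨ ℕ.+-comm (inversions n w′) 1 ⟩
      suc (inversions n w′) ∎
      where open ≡-Reasoning

    N-swap : N n w′ ≡ N n w ℤ.+ + 1
    N-swap = begin
      + descentWeight n w′ ℤ.- + inversions n w′
        ≡⟨ cong (λ d → + d ℤ.- + inversions n w′) descentWeight-swap ⟩
      + descentWeight n w ℤ.- + inversions n w′
        ≡⟨ [+m]-[+n]≡[+m]-[+1+n]+1 (descentWeight n w) (inversions n w′) ⟩
      (+ descentWeight n w ℤ.- + suc (inversions n w′)) ℤ.+ + 1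
        ≡⟨ cong (λ i → (+ descentWeight n w ℤ.- + i) ℤ.+ + 1) (sym inversions-swap) ⟩
      N n w ℤ.+ + 1 ∎
      where open ≡-Reasoning

  module Rotation {n a v} (p : IsPermWord (suc n) (a ∷ v)) where

    private
      w w′ : List ℕ
      w = a ∷ v
      w′ = v ++ [ a ]

      a∉v : a ∉ v
      a∉v with IsPermWord-unique p
      ... | a∉ ∷ _ = λ a∈v → All.lookup a∉ a∈v refl

      a∈ : InRange (suc n) a
      a∈ = IsPermWord-∈⁻ p (here refl)

      ∈v : ∀ {i} → InRange (suc n) i → i ≢ a → i ∈ v
      ∈v i∈ i≢a with IsPermWord-∈⁺ p i∈
      ... | here i≡a = ⊥-elim (i≢a i≡a)
      ... | there i∈v = i∈v

      below-a : ∀ {i} → InRange (a ∸ 1) i → InRange (suc n) i × i ≢ a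
      below-a {i} i∈@(1≤i , _) =
        (1≤i , ℕ.≤-trans (ℕ.<⇒≤ i<a) (proj₂ a∈)) , ℕ.<⇒≢ i<a
        where
        i<a : i < a
        i<a = InRange-∸1⇒< (proj₁ a∈) i∈

      γ-a-j : ∀ {j} → j ≢ a → γ a j w ≡ 0
      γ-a-j {j} j≢a rewrite ≢⇒≡ᵇ≡false {a} {j} (j≢a ∘ sym) | ≡ᵇ-refl a = refl

      γ-a-j′ : ∀ {j} → InRange (suc n) j → j ≢ a → γ a j w′ ≡ 1
      γ-a-j′ j∈ j≢a rewrite before-true v [ a ] (∈v j∈ j≢a) a∉v = refl

      γ-i-a : ∀ i → γ i a w ≡ 1
      γ-i-a i rewrite ≡ᵇ-refl a = refl

      γ-i-a′ : ∀ {i} → InRange (suc n) i → i ≢ a → γ i a w′ ≡ 0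
      γ-i-a′ i∈ i≢a rewrite before-false v [ a ] (∈v i∈ i≢a) a∉v = refl

      γ-other : ∀ {i j} → InRange (suc n) j → i ≢ a → j ≢ a → γ i j w′ ≡ γ i j w
      γ-other {i} {j} j∈ i≢a j≢a
        rewrite before-++ˡ v [ a ] {j} {i} (inj₁ (∈v j∈ j≢a))
              | ≢⇒≡ᵇ≡false {a} {j} (j≢a ∘ sym) | ≢⇒≡ᵇ≡false {a} {i} (i≢a ∘ sym)
        = refl

      descent-term : ∀ k → InRange n k → γ k (suc k) w′ + δ (suc k) a ≡ γ k (suc k) w + δ k a
      descent-term k (1≤k , k≤n) with k ≟ a
      ... | yes refl
        rewrite γ-a-j′ (s≤s z≤n , s≤s k≤n) (ℕ.>⇒≢ (ℕ.n<1+n k))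
              | γ-a-j (ℕ.>⇒≢ (ℕ.n<1+n k)) | δ-≢ (ℕ.>⇒≢ (ℕ.n<1+n k)) | δ-refl k
        = refl
      ... | no k≢a with suc k ≟ a
      ...   | yes refl
        rewrite γ-i-a′ (1≤k , ℕ.m≤n⇒m≤1+n k≤n) k≢a
              | γ-i-a k | δ-refl (suc k) | δ-≢ k≢a
        = refl
      ...   | no 1+k≢a
        rewrite γ-other (s≤s z≤n , s≤s k≤n) k≢a 1+k≢a | δ-≢ k≢a | δ-≢ 1+k≢a
        = refl

      inversionsAt-a : inversionsAt a w ≡ a ∸ 1
      inversionsAt-a = trans (cong sum (List.map-cong γ-i-a (one-to (a ∸ 1)))) (sum-one-to-1 (a ∸ 1))

      inversionsAt-a′ : inversionsAt a w′ ≡ 0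
      inversionsAt-a′ = trans
        (sum-one-to-cong (a ∸ 1) (λ i i∈ → uncurry γ-i-a′ (below-a i∈)))
        (sum-map-0 (one-to (a ∸ 1)))

      inversions-term : ∀ j → InRange (suc n) j →
        inversionsAt j w′ + (j ∸ 1) * δ j a
          ≡ inversionsAt j w + sum (map (λ i → 1 * δ i a) (one-to (j ∸ 1)))
      inversions-term j j∈ with j ≟ a
      ... | yes refl
        rewrite inversionsAt-a | inversionsAt-a′ | δ-refl j
              | sum-δ-∉ (λ _ → 1) (j ∸ 1) (λ j∈ → proj₂ (below-a j∈) refl)
        = trans (ℕ.*-identityʳ (j ∸ 1)) (sym (ℕ.+-identityʳ (j ∸ 1)))
      ... | no j≢a rewrite δ-≢ j≢a | ℕ.*-zeroʳ (j ∸ 1) | ℕ.+-identityʳ (inversionsAt j w′) =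
        trans (sum-one-to-cong (j ∸ 1) γ-i-j)
          (sum-map-+ (λ i → γ i j w) (λ i → 1 * δ i a) (one-to (j ∸ 1)))
        where
        γ-i-j : ∀ i → InRange (j ∸ 1) i → γ i j w′ ≡ γ i j w + 1 * δ i a
        γ-i-j i _ with i ≟ a
        ... | yes refl rewrite γ-a-j′ j∈ j≢a | γ-a-j j≢a | δ-refl i = refl
        ... | no i≢a rewrite δ-≢ i≢a | ℕ.+-identityʳ (γ i j w) = γ-other j∈ i≢a j≢a

    descentWeight-rotate :
      descentWeight (suc n) w′ + weight (suc n) (a ∸ 1) ≡ descentWeight (suc n) w + weight (suc n) a
    descentWeight-rotate = begin
      descentWeight (suc n) w′ + h (a ∸ 1)
        ≡⟨ cong (_+_ _) (sym (sum-δ-suc h n refl (weight-self (suc n)) a∈)) ⟩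
      descentWeight (suc n) w′ + sum (map (λ k → h k * δ (suc k) a) (one-to n))
        ≡⟨ sym (sum-map-+ (λ k → h k * γ k (suc k) w′) (λ k → h k * δ (suc k) a) (one-to n)) ⟩
      sum (map (λ k → h k * γ k (suc k) w′ + h k * δ (suc k) a) (one-to n))
        ≡⟨ sum-one-to-cong n (λ k k∈ → distribute k (descent-term k k∈)) ⟩
      sum (map (λ k → h k * γ k (suc k) w + h k * δ k a) (one-to n))
        ≡⟨ sum-map-+ (λ k → h k * γ k (suc k) w) (λ k → h k * δ k a) (one-to n) ⟩
      descentWeight (suc n) w + sum (map (λ k → h k * δ k a) (one-to n))
        ≡⟨ cong (_+_ _) (sum-δ h n a refl (weight-self (suc n)) (proj₂ a∈)) ⟩
      descentWeight (suc n) w + h a ∎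
      where
      open ≡-Reasoning
      h : ℕ → ℕ
      h = weight (suc n)
      distribute : ∀ k {b c d e} → b + c ≡ d + e → h k * b + h k * c ≡ h k * d + h k * e
      distribute k {b} {c} {d} {e} b+c≡d+e = begin
        h k * b + h k * c  ≡⟨ sym (ℕ.*-distribˡ-+ (h k) b c) ⟩
        h k * (b + c)      ≡⟨ cong (h k *_) b+c≡d+e ⟩
        h k * (d + e)      ≡⟨ ℕ.*-distribˡ-+ (h k) d e ⟩
        h k * d + h k * e  ∎

    inversions-rotate : inversions (suc n) w′ + (a ∸ 1) ≡ inversions (suc n) w + (suc n ∸ a)
    inversions-rotate = begin
      inversions (suc n) w′ + (a ∸ 1)
        ≡⟨ cong (_+_ _) (sym (sum-δ-∈ (λ j → j ∸ 1) (suc n) a∈)) ⟩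
      inversions (suc n) w′ + sum (map (λ j → (j ∸ 1) * δ j a) (one-to (suc n)))
        ≡⟨ sym (sum-map-+ (λ j → inversionsAt j w′) (λ j → (j ∸ 1) * δ j a) (one-to (suc n))) ⟩
      sum (map (λ j → inversionsAt j w′ + (j ∸ 1) * δ j a) (one-to (suc n)))
        ≡⟨ sum-one-to-cong (suc n) inversions-term ⟩
      sum (map (λ j → inversionsAt j w + C j) (one-to (suc n)))
        ≡⟨ sum-map-+ (λ j → inversionsAt j w) C (one-to (suc n)) ⟩
      inversions (suc n) w + sum (map C (one-to (suc n)))
        ≡⟨ cong (_+_ _) (sum-δ-below (suc n) (proj₁ a∈)) ⟩
      inversions (suc n) w + (suc n ∸ a) ∎
      where
      open ≡-Reasoning
      C : ℕ → ℕ
      C j = sum (map (λ i → 1 * δ i a) (one-to (j ∸ 1)))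

    N-rotate : N (suc n) w′ ≡ N (suc n) w
    N-rotate =
      [+m]-[+n]≡[+p]-[+q] {D′} {I′} {D} {I} (ℕ.+-cancelʳ-≡ X (D′ + I) (D + I′) balance)
      where
      open ≡-Reasoning
      D D′ I I′ X : ℕ
      D = descentWeight (suc n) w
      D′ = descentWeight (suc n) w′
      I = inversions (suc n) w
      I′ = inversions (suc n) w′
      X = weight (suc n) (a ∸ 1) + (suc n ∸ a)
      interchange : ∀ a b c d → a + b + (c + d) ≡ (a + c) + (b + d)
      interchange = solve-∀
      balance : D′ + I + X ≡ D + I′ + X
      balance = begin
        D′ + I + X
          ≡⟨ interchange D′ I (weight (suc n) (a ∸ 1)) (suc n ∸ a) ⟩
        (D′ + weight (suc n) (a ∸ 1)) + (I + (suc n ∸ a))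
          ≡⟨ cong₂ _+_ descentWeight-rotate (sym inversions-rotate) ⟩
        (D + weight (suc n) a) + (I′ + (a ∸ 1))
          ≡⟨ sym (interchange D I′ (weight (suc n) a) (a ∸ 1)) ⟩
        D + I′ + (weight (suc n) a + (a ∸ 1))
          ≡⟨ cong (_+_ (D + I′)) (sym (weight-pred (proj₁ a∈) (proj₂ a∈))) ⟩
        D + I′ + X ∎

  -- The poset of circular permutations, graded by N

  N-rotate-prefix : ∀ {n} x y → IsPermWord (suc n) (x ++ y) →
    N (suc n) (x ++ y) ≡ N (suc n) (y ++ x)
  N-rotate-prefix {n} [] y _ = cong (N (suc n)) (sym (List.++-identityʳ y))
  N-rotate-prefix {n} (c ∷ x) y p = begin
    N (suc n) (c ∷ x ++ y)         ≡⟨ sym (Rotation.N-rotate p) ⟩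
    N (suc n) ((x ++ y) ++ [ c ])  ≡⟨ cong (N (suc n)) (List.++-assoc x y [ c ]) ⟩
    N (suc n) (x ++ y ++ [ c ])    ≡⟨ N-rotate-prefix x (y ++ [ c ]) p′ ⟩
    N (suc n) ((y ++ [ c ]) ++ x)  ≡⟨ cong (N (suc n)) (List.++-assoc y [ c ] x) ⟩
    N (suc n) (y ++ c ∷ x)         ∎
    where
    open ≡-Reasoning
    p′ : IsPermWord (suc n) (x ++ y ++ [ c ])
    p′ = ↭-trans (↭.++⁺ˡ x (↭.++-comm y [ c ])) (↭-trans (↭.shift c x y) p)

  N-Conj : ∀ {n w v} → IsPermWord (suc n) w → Conj w v → N (suc n) w ≡ N (suc n) v
  N-Conj p (x , y , refl , refl) = N-rotate-prefix x y p

  N-Step : ∀ {n w v} → IsPermWord (suc n) w → Step w v → N (suc n) v ≡ N (suc n) w ℤ.+ + 1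
  N-Step {n} {w} {v} p (_ , x , y , s , r , w~u , refl , r+1<s , u′~v) = begin
    N (suc n) v                           ≡⟨ sym (N-Conj pu′ u′~v) ⟩
    N (suc n) (x ++ r ∷ s ∷ y)            ≡⟨ SwapFactor.N-swap pu r+1<s ⟩
    N (suc n) (x ++ s ∷ r ∷ y) ℤ.+ + 1    ≡⟨ cong (ℤ._+ + 1) (sym (N-Conj p w~u)) ⟩
    N (suc n) w ℤ.+ + 1                   ∎
    where
    open ≡-Reasoning
    pu : IsPermWord (suc n) (x ++ s ∷ r ∷ y)
    pu = IsPermWord-resp-Leq (inj₁ w~u ◅ ε) p
    pu′ : IsPermWord (suc n) (x ++ r ∷ s ∷ y)
    pu′ = ↭-trans (↭.++⁺ˡ x (↭-swap r s ↭-refl)) pu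

  γ-one-to : ∀ m {i j} → 1 ≤ i → i < j → γ i j (one-to m) ≡ 0
  γ-one-to m 1≤i i<j rewrite before-one-to m 1≤i i<j = refl

  N-one-to : ∀ n → N n (one-to n) ≡ + 0
  N-one-to n = cong₂ (λ d i → + d ℤ.- + i) no-descents no-inversions
    where
    no-descents : descentWeight n (one-to n) ≡ 0
    no-descents = trans
      (sum-one-to-cong (n ∸ 1) (λ k (1≤k , _) →
        trans (cong (weight n k *_) (γ-one-to n 1≤k (ℕ.n<1+n k))) (ℕ.*-zeroʳ (weight n k))))
      (sum-map-0 (one-to (n ∸ 1)))
    no-inversionsAt : ∀ j → InRange n j → inversionsAt j (one-to n) ≡ 0
    no-inversionsAt j (1≤j , _) = trans
      (sum-one-to-cong (j ∸ 1) (λ i i∈ → γ-one-to n (proj₁ i∈) (InRange-∸1⇒< 1≤j i∈)))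
      (sum-map-0 (one-to (j ∸ 1)))
    no-inversions : inversions n (one-to n) ≡ 0
    no-inversions = trans (sum-one-to-cong n no-inversionsAt) (sum-map-0 (one-to n))

  N-mono : ∀ {n w v} → IsPermWord (suc n) w → Leq w v → N (suc n) w ℤ.≤ N (suc n) v
  N-mono p ε = ℤₚ.≤-refl
  N-mono p (inj₁ w~u ◅ u≤v) =
    ℤₚ.≤-trans (ℤₚ.≤-reflexive (N-Conj p w~u))
      (N-mono (IsPermWord-resp-Leq (inj₁ w~u ◅ ε) p) u≤v)
  N-mono p (inj₂ w→u ◅ u≤v) =
    ℤₚ.≤-trans (ℤₚ.≤-trans (ℤₚ.i≤i+j _ (+ 1)) (ℤₚ.≤-reflexive (sym (N-Step p w→u))))
      (N-mono (IsPermWord-resp-Leq (inj₂ w→u ◅ ε) p) u≤v)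

  Leq-uncons : ∀ {w v} → Leq w v → Conj w v ⊎ ∃[ c ] ∃[ d ] (Conj w c × Step c d × Leq d v)
  Leq-uncons {w} ε = inj₁ (Conj-refl w)
  Leq-uncons (inj₁ w~u ◅ u≤v) with Leq-uncons u≤v
  ... | inj₁ u~v = inj₁ (Conj-trans w~u u~v)
  ... | inj₂ (c , d , u~c , c→d , d≤v) = inj₂ (c , d , Conj-trans w~u u~c , c→d , d≤v)
  Leq-uncons {w} (inj₂ w→u ◅ u≤v) = inj₂ (w , _ , Conj-refl w , w→u , u≤v)

  N-Conj-Step : ∀ {n w c d} → IsPermWord (suc n) w → Conj w c → Step c d →
    N (suc n) d ≡ N (suc n) w ℤ.+ + 1
  N-Conj-Step p w~c c→d =
    trans (N-Step (IsPermWord-resp-Leq (inj₁ w~c ◅ ε) p) c→d)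
      (cong (ℤ._+ + 1) (sym (N-Conj p w~c)))

  i≢i+1 : ∀ {i} → i ≢ i ℤ.+ + 1
  i≢i+1 {i} i≡i+1 = ℤₚ.i≢suc[i] (trans i≡i+1 (ℤₚ.+-comm i (+ 1)))

  Leq-antisym : ∀ {n w v} → IsPermWord (suc n) w → Leq w v → Leq v w → Conj w v
  Leq-antisym {n} {w} {v} p w≤v v≤w with Leq-uncons w≤v
  ... | inj₁ w~v = w~v
  ... | inj₂ (c , d , w~c , c→d , d≤v) =
    ⊥-elim (i≢i+1 (ℤₚ.≤-antisym (ℤₚ.i≤i+j _ (+ 1)) N[w]+1≤N[w]))
    where
    open ℤₚ.≤-Reasoning
    w≤d : Leq w d
    w≤d = inj₁ w~c ◅ inj₂ c→d ◅ ε
    N[w]+1≤N[w] : N (suc n) w ℤ.+ + 1 ℤ.≤ N (suc n) w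
    N[w]+1≤N[w] = begin
      N (suc n) w ℤ.+ + 1   ≡⟨ sym (N-Conj-Step p w~c c→d) ⟩
      N (suc n) d           ≤⟨ N-mono (IsPermWord-resp-Leq w≤d p) d≤v ⟩
      N (suc n) v           ≤⟨ N-mono (IsPermWord-resp-Leq w≤v p) v≤w ⟩
      N (suc n) w           ∎

  ≤ᶜ-isPartialOrder : ∀ n → IsPartialOrder (_≈ᶜ_ {suc n}) (_≤ᶜ_ {suc n})
  ≤ᶜ-isPartialOrder n = record
    { isPreorder = record
      { isEquivalence = record
        { refl = λ {a} → Conj-refl (proj₁ a) ; sym = Conj-sym ; trans = Conj-trans }
      ; reflexive = λ a~b → inj₁ a~b ◅ ε
      ; trans = _◅◅_
      }
    ; antisym = λ {a} → Leq-antisym (proj₂ a)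
    }

  N-cover : ∀ {n} (a b : CircPerm (suc n)) → a ⋖ᶜ b →
    N (suc n) (proj₁ b) ≡ N (suc n) (proj₁ a) ℤ.+ + 1
  N-cover (w , p) (v , q) (w≤v , w≁v , between) with Leq-uncons w≤v
  ... | inj₁ w~v = ⊥-elim (w≁v w~v)
  ... | inj₂ (c , d , w~c , c→d , d≤v)
      with between (d , IsPermWord-resp-Leq w~c→d p) w~c→d d≤v
    where
    w~c→d : Leq w d
    w~c→d = inj₁ w~c ◅ inj₂ c→d ◅ ε
  ...   | inj₁ d~w = ⊥-elim (i≢i+1 (trans (N-Conj p (Conj-sym d~w)) (N-Conj-Step p w~c c→d)))
  ...   | inj₂ d~v = trans (N-Conj q (Conj-sym d~v)) (N-Conj-Step p w~c c→d)

  -- The largest and the smallest element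

  Insert : ℕ → List ℕ → List ℕ → Set
  Insert t v w = ∃[ p ] ∃[ q ] (Conj v (p ++ q) × w ≡ p ++ t ∷ q)

  Insert-resp-Conj : ∀ {t v v′ w} → Conj v v′ → Insert t v w → Insert t v′ w
  Insert-resp-Conj v~v′ (p , q , v~pq , w≡) = p , q , Conj-trans (Conj-sym v~v′) v~pq , w≡

  Conj-insert : ∀ t p q {u} → Conj (p ++ q) u →
    ∃[ p′ ] ∃[ q′ ] (u ≡ p′ ++ q′ × Conj (p ++ t ∷ q) (p′ ++ t ∷ q′))
  Conj-insert t p q (A , B , pq≡AB , refl) with ++-≡-++-split p q A B pq≡AB
  ... | inj₁ (m , refl , refl) = B ++ p , m , sym (List.++-assoc B p m) ,
        (p ++ t ∷ m , B , sym (List.++-assoc p (t ∷ m) B) , List.++-assoc B p (t ∷ m))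
  ... | inj₂ (m , refl , refl) = m , q ++ A , List.++-assoc m q A ,
        (A , m ++ t ∷ q , List.++-assoc A m (t ∷ q) , sym (List.++-assoc m (t ∷ q) A))

  Insert-at : ∀ {t v′ u′} p q → Conj u′ v′ → u′ ≡ p ++ q → Insert t v′ (p ++ t ∷ q)
  Insert-at p q u′~v′ u′≡pq =
    p , q , Conj-trans (Conj-sym u′~v′) (Conj-reflexive u′≡pq) , refl

  Insert-Step : ∀ {t v v′ w} → All (_< t) v → Step v v′ → Insert t v w →
    ∃[ w′ ] (Insert t v′ w′ × Leq w w′)
  Insert-Step {t} v<t (_ , x , y , s , r , v~u , refl , r+1<s , u′~v′) (p , q , v~pq , refl)
    with Conj-insert t p q (Conj-trans (Conj-sym v~pq) v~u)
  ... | p′ , q′ , u≡p′q′ , w~ with ++-≡-++-split p′ q′ x (s ∷ r ∷ y) (sym u≡p′q′)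
  ... | inj₁ (m , refl , refl) =
    _ , Insert-at p′ (m ++ r ∷ s ∷ y) u′~v′ (List.++-assoc p′ m _) ,
    inj₁ w~ ◅ inj₂ (swap-Step (p′ ++ t ∷ m) s r y
                      (sym (List.++-assoc p′ (t ∷ m) _)) r+1<s
                      (sym (List.++-assoc p′ (t ∷ m) _))) ◅ ε
  ... | inj₂ ([] , refl , refl) =
    _ , Insert-at (x ++ []) (r ∷ s ∷ y) u′~v′ (cong (_++ r ∷ s ∷ y) (sym (List.++-identityʳ x))) ,
    inj₁ w~ ◅ inj₂ (swap-Step ((x ++ []) ++ [ t ]) s r y
                      (sym (List.++-assoc (x ++ []) [ t ] _)) r+1<s
                      (sym (List.++-assoc (x ++ []) [ t ] _))) ◅ ε
  ... | inj₂ (_ ∷ [] , refl , refl) =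
    _ , Insert-at (x ++ r ∷ s ∷ []) y u′~v′ (sym (List.++-assoc x (r ∷ s ∷ []) y)) ,
    inj₁ w~ ◅ inj₂ (swap-Step (x ++ [ s ]) t r y refl r+1<t refl)
            ◅ inj₂ (swap-Step x s r (t ∷ y)
                      (List.++-assoc x [ s ] _) r+1<s (List.++-assoc x (r ∷ s ∷ []) _)) ◅ ε
    where
    s<t : s < t
    s<t = All.lookup (↭.All-resp-↭ (Conj⇒↭ v~u) v<t) (∈-++⁺ʳ x (here refl))
    r+1<t : suc r < t
    r+1<t = ℕ.<-trans r+1<s s<t
  ... | inj₂ (_ ∷ _ ∷ m , refl , refl) =
    _ , Insert-at (x ++ r ∷ s ∷ m) q′ u′~v′ (sym (List.++-assoc x (r ∷ s ∷ m) q′)) ,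
    inj₁ w~ ◅ inj₂ (swap-Step x s r (m ++ t ∷ q′)
                      (List.++-assoc x (s ∷ r ∷ m) _) r+1<s (List.++-assoc x (r ∷ s ∷ m) _)) ◅ ε

  Insert-Leq : ∀ {t v v′ w} → All (_< t) v → Leq v v′ → Insert t v w →
    ∃[ w′ ] (Insert t v′ w′ × Leq w w′)
  Insert-Leq _ ε ins = _ , ins , ε
  Insert-Leq v<t (inj₁ v~u ◅ u≤v′) ins =
    Insert-Leq (↭.All-resp-↭ (Conj⇒↭ v~u) v<t) u≤v′ (Insert-resp-Conj v~u ins)
  Insert-Leq v<t (inj₂ v→u ◅ u≤v′) ins with Insert-Step v<t v→u ins
  ... | w₁ , ins₁ , w≤w₁ with Insert-Leq (↭.All-resp-↭ (Step⇒↭ v→u) v<t) u≤v′ ins₁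
  ...   | w′ , ins′ , w₁≤w′ = w′ , ins′ , w≤w₁ ◅◅ w₁≤w′

  carry-right : ∀ {t} R Q P → All (λ r → suc r < t) Q → Leq (R ++ t ∷ Q ++ P) (R ++ Q ++ t ∷ P)
  carry-right R [] P _ = ε
  carry-right {t} R (r ∷ Q) P (r+1<t ∷ Q<t) =
    inj₂ (swap-Step R t r (Q ++ P) refl r+1<t refl)
    ◅ inj₁ (Conj-reflexive (sym (List.++-assoc R [ r ] _)))
    ◅ carry-right (R ++ [ r ]) Q P Q<t
    ◅◅ inj₁ (Conj-reflexive (List.++-assoc R [ r ] _)) ◅ ε

  to-one-suffix-bounded : ∀ m x₀ X Y → to-one m ≡ x₀ ∷ X ++ Y → All (λ r → suc r < suc m) Y
  to-one-suffix-bounded (suc m) x₀ X Y to-one≡ =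
    All.map (s≤s ∘ s≤s) (All.++⁻ʳ X (subst (All (_≤ m)) X++Y≡to-one (to-one-bounded m)))
    where
    X++Y≡to-one : to-one m ≡ X ++ Y
    X++Y≡to-one = List.∷-injectiveʳ (trans (sym (to-one-suc m)) to-one≡)

  Insert-to-one : ∀ {m w} → Insert (suc m) (to-one m) w → Leq w (to-one (suc m))
  Insert-to-one {m} (P , Q , to-one~PQ , refl) with Conj-trans to-one~PQ (P , Q , refl , refl)
  ... | [] , Y , to-one≡Y , QP≡Y =
    inj₁ (Conj-trans (P , suc m ∷ Q , refl , refl) (Conj-reflexive (begin
      suc m ∷ Q ++ P     ≡⟨ cong (suc m ∷_) (trans QP≡Y (List.++-identityʳ Y)) ⟩
      suc m ∷ Y          ≡⟨ cong (suc m ∷_) (sym to-one≡Y) ⟩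
      suc m ∷ to-one m   ≡⟨ sym (to-one-suc m) ⟩
      to-one (suc m)     ∎))) ◅ ε
    where open ≡-Reasoning
  ... | x₀ ∷ X , Y , to-one≡XY , QP≡YX =
    inj₁ (Conj-trans (P , suc m ∷ Q , refl , refl) (Conj-reflexive (cong (suc m ∷_) QP≡YX)))
    ◅ carry-right [] Y (x₀ ∷ X) (to-one-suffix-bounded m x₀ X Y to-one≡XY)
    ◅◅ (inj₁ (Conj-trans (Y , suc m ∷ x₀ ∷ X , refl , refl)
               (Conj-reflexive (trans (cong (suc m ∷_) (sym to-one≡XY)) (sym (to-one-suc m))))) ◅ ε)

  IsPermWord-remove : ∀ {m} P {Q} → IsPermWord (suc m) (P ++ suc m ∷ Q) → IsPermWord m (P ++ Q)
  IsPermWord-remove {m} P {Q} p =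
    subst (P ++ Q ↭_) (List.++-identityʳ (one-to m))
      (↭.drop-mid P (one-to m) (subst (P ++ suc m ∷ Q ↭_) (one-to-snoc m) p))

  Leq-to-one : ∀ {n w} → IsPermWord n w → Leq w (to-one n)
  Leq-to-one {zero} p rewrite ↭.↭-empty-inv p = ε
  Leq-to-one {suc m} p with ∈-∃++ (IsPermWord-∈⁺ p (s≤s z≤n , ℕ.≤-refl))
  ... | P , Q , refl
      with Insert-Leq (All.map s≤s (IsPermWord-bounded (IsPermWord-remove P p)))
             (Leq-to-one (IsPermWord-remove P p)) (P , Q , Conj-refl (P ++ Q) , refl)
  ...   | w′ , ins , w≤w′ = w≤w′ ◅◅ Insert-to-one ins

  one-to-Leq : ∀ {n w} → IsPermWord n w → Leq (one-to n) w
  one-to-Leq {n} {w} p = subst₂ Leq (List.reverse-involutive (one-to n)) (List.reverse-involutive w)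
    (reverse-Leq (Leq-to-one (↭-trans (↭.↭-reverse w) p)))

open import Defs
open import Data.Nat using (ℕ; _≤_; suc)
open import Data.Integer using (+_; _+_)
open import Data.Product using (_×_; _,_; proj₁; proj₂)
open import Function using (_∘_)
open import Relation.Binary.PropositionalEquality using (_≡_)
open import Relation.Binary.Structures using (IsPartialOrder)

corollary2p3 : (n : ℕ) → 1 ≤ n →
    IsPartialOrder (_≈ᶜ_ {n}) (_≤ᶜ_ {n})
    × (N n (one-to n) ≡ + 0)
    × ((a b : CircPerm n) → a ⋖ᶜ b → N n (proj₁ b) ≡ N n (proj₁ a) + + 1)
    × ((a : CircPerm n) → Leq (one-to n) (proj₁ a))
    × ((a : CircPerm n) → Leq (proj₁ a) (to-one n))
corollary2p3 (suc n) _ =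
  ≤ᶜ-isPartialOrder n , N-one-to (suc n) , N-cover , (one-to-Leq ∘ proj₂) , (Leq-to-one ∘ proj₂)
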